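{- Let $\alpha$ be any positive real and let $r\geq 2$ be any integer such that $r\alpha\geq 1$. There exists no algorithm solving fuel-constrained exploration for all instances $(G=(V,E),l_s,\alpha)$ of $\mathcal{I}(\alpha,r)$ with a penalty linear in $|V|$; that is, for every algorithm $A(\alpha,r)$ solving fuel-constrained exploration for all instances of $\mathcal{I}(\alpha,r)$ and every constant $C>0$, there is an instance $(G=(V,E),l_s,\alpha)\in\mathcal{I}(\alpha,r)$ on which the penalty of $A$ exceeds $C|V|$.
   Context: Model. A mobile agent explores a finite, simple, undirected, connected graph $G=(V,E)$ starting from a source node $s$. Nodes have pairwise distinct integer labels; at each node $v$ the incident edges carry distinct local port numbers $0,\dots,\deg(v)-1$, with no relation between the two ports of an edge. Initially the agent knows only the label and degree of $s$. It runs a deterministic algorithm: at each step the algorithm, based on everything memorized so far, chooses a port at the current node and the agent traverses the corresponding edge; on arrival it learns the label and degree of the new node and the incoming port number. The agent has unbounded memory. Exploration requires traversing every edge (hence visiting every node) at least once. Fuel-constrained exploration: let $r$ be the eccentricity of $s$ in $G$ and $\alpha>0$ a real constant with $r\alpha\geq 1$. The agent has a fuel tank of size $B=2(1+\alpha)r$ that can be refilled only at $s$: it may make at most $\lfloor B\rfloor$ edge traversals between two consecutive visits to $s$ (starting from $s$). Both $\alpha$ and $r$ are given to the algorithm in advance. An instance is a tuple $(G,l_s,\alpha)$ where $l_s$ is the label of $s$; $\mathcal{I}(\alpha,r)$ denotes the set of all instances $(G,l_s,\alpha)$ in which the eccentricity of the node labeled $l_s$ is $r$. The penalty of an algorithm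 on an instance with graph $G=(V,E)$ is the number of edge traversals it performs in excess of $|E|$.
   Formalization: The parameter α ranges over the positive rationals rather than any positive real, and the constant C is likewise taken to be a positive rational. -}

module Defs where

open import Data.Nat using (ℕ; zero; suc; _+_; _*_; _∸_; _≤_; _<_; _<?_; _/_)
open import Data.Integer using (ℤ; +_) renaming (∣_∣ to absℤ)
open import Data.Fin using (Fin; fromℕ<; toℕ)
open import Data.List using (List; []; _∷_; map; allFin)
open import Data.Nat.ListAction using (sum)
open import Data.List.Membership.Propositional using (_∈_)
open import Data.Maybe using (Maybe; just; nothing)
open import Data.Product using (Σ; ∃; ∃-syntax; _×_; _,_; proj₁; proj₂)
open import Data.Sum using (_⊎_)
open import Relation.Nullary using (¬_; yes; no)
open import Relation.Binary.PropositionalEquality using (_≡_; _≢_)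
open import Function.Definitions using (Injective)
import Data.Rational as ℚ
open ℚ using (ℚ)

-- A finite, simple, undirected graph with node set Fin n, pairwise distinct
-- integer labels, and a local port numbering 0..deg(v)-1 at each node v.
-- adj v p = (w , q): the edge at port p of v leads to w and has port q at w.
record PortGraph : Set where
  field
    n       : ℕ
    deg     : Fin n → ℕ
    adj     : (v : Fin n) → Fin (deg v) → Σ (Fin n) (λ w → Fin (deg w))
    adj-inv : ∀ v p → adj (proj₁ (adj v p)) (proj₂ (adj v p)) ≡ (v , p)
    no-loop  : ∀ v p → proj₁ (adj v p) ≢ v
    no-multi : ∀ v p q → proj₁ (adj v p) ≡ proj₁ (adj v q) → p ≡ q
    label     : Fin n → ℤ
    label-inj : Injective _≡_ _≡_ label

open PortGraph public

-- Darts = (node, port) pairs; every edge corresponds to two darts.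
Dart : PortGraph → Set
Dart G = Σ (Fin (n G)) (λ v → Fin (deg G v))

numNodes : PortGraph → ℕ
numNodes G = n G

-- |E| = (sum of degrees) / 2   (handshake; each edge has two ports)
numEdges : PortGraph → ℕ
numEdges G = sum (map (deg G) (allFin (n G))) / 2

data Walk (G : PortGraph) : Fin (n G) → Fin (n G) → ℕ → Set where
  here : ∀ {u} → Walk G u u 0
  step : ∀ {u v k} (p : Fin (deg G u)) →
         Walk G (proj₁ (adj G u p)) v k → Walk G u v (suc k)

Distance : (G : PortGraph) → Fin (n G) → Fin (n G) → ℕ → Set
Distance G u v d = Walk G u v d × (∀ k → Walk G u v k → d ≤ k)

-- eccentricity of s is r (in particular G is connected)
Eccentricity : (G : PortGraph) → Fin (n G) → ℕ → Set
Eccentricity G s r =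
  (∀ v → ∃[ d ] (Distance G s v d × d ≤ r)) × (∃[ v ] Distance G s v r)

-- What the agent learns on arriving at a node: (label, degree, incoming port).
Obs : Set
Obs = ℤ × ℕ × ℕ

-- A deterministic algorithm: given the label and degree of s and the
-- history of all observations so far (most recent first), it either stops
-- (nothing) or chooses a port (just p) at the current node.
Algorithm : Set
Algorithm = (ℤ × ℕ) → List Obs → Maybe ℕ

-- State of the execution after k traversals (if the agent has indeed made k
-- valid traversals): current node, history, traversed darts (most recent first).
State : PortGraph → Set
State G = Fin (n G) × List Obs × List (Dart G)

runFor : Algorithm → (G : PortGraph) → Fin (n G) → ℕ → Maybe (State G)
runFor A G s zero = just (s , [] , [])
runFor A G s (suc k) with runFor A G s k
... | nothing = nothing
... | just (v , h , ds) with A (label G s , deg G s) h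
...   | nothing = nothing
...   | just p with p <? deg G v
...     | no _ = nothing
...     | yes p<d =
          let pp = fromℕ< p<d
              w  = proj₁ (adj G v pp)
              q  = proj₂ (adj G v pp)
          in just (w , (label G w , deg G w , toℕ q) ∷ h , (v , pp) ∷ ds)

posAt : Algorithm → (G : PortGraph) → Fin (n G) → ℕ → Maybe (Fin (n G))
posAt A G s k with runFor A G s k
... | nothing = nothing
... | just (v , _ , _) = just v

HaltsWith : Algorithm → (G : PortGraph) → Fin (n G) → ℕ → List (Dart G) → Set
HaltsWith A G s T ds =
  ∃[ v ] ∃[ h ] (runFor A G s T ≡ just (v , h , ds) × A (label G s , deg G s) h ≡ nothing)

-- Fuel constraint with F = ⌊B⌋: after any visit to s at time i, if the walk
-- continues for more than F traversals, the agent is back at s within F traversals.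
RespectsFuel : Algorithm → (G : PortGraph) → Fin (n G) → ℕ → ℕ → Set
RespectsFuel A G s F T =
  ∀ i → i + F < T → posAt A G s i ≡ just s →
    ∃[ k ] (i < k × k ≤ i + F × posAt A G s k ≡ just s)

CoversAllEdges : (G : PortGraph) → List (Dart G) → Set
CoversAllEdges G ds = ∀ (e : Dart G) → e ∈ ds ⊎ adj G (proj₁ e) (proj₂ e) ∈ ds

ExploresIn : Algorithm → (G : PortGraph) → Fin (n G) → ℕ → ℕ → Set
ExploresIn A G s F T =
  ∃[ ds ] (HaltsWith A G s T ds × RespectsFuel A G s F T × CoversAllEdges G ds)

tank : ℚ → ℕ → ℚ
tank α r = (+ 2 ℚ./ 1) ℚ.* ((ℚ.1ℚ ℚ.+ α) ℚ.* (+ r ℚ./ 1))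

fuel : ℚ → ℕ → ℕ
fuel α r = absℤ (ℚ.floor (tank α r))

-- instance (G, l_s, α) ∈ I(α,r): the source s (the node labelled l_s) has eccentricity r
InInstances : (G : PortGraph) → Fin (n G) → ℕ → Set
InInstances G s r = Eccentricity G s r

SolvesAll : ℚ → ℕ → Algorithm → Set
SolvesAll α r A =
  ∀ (G : PortGraph) (s : Fin (n G)) → InInstances G s r →
    ∃[ T ] ExploresIn A G s (fuel α r) T

-- penalty T - |E| exceeds C|V|
PenaltyExceeds : (G : PortGraph) → ℕ → ℚ → Set
PenaltyExceeds G T C =
  C ℚ.* (+ numNodes G ℚ./ 1) ℚ.< (+ T ℚ./ 1) ℚ.- (+ numEdges G ℚ./ 1)

{-# OPTIONS --safe #-}
module Submission where

-- The witness is a lollipop: a path 0 — 1 — ⋯ — h from the source 0, glued at h to a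
-- clique on the nodes h, …, h + M. The source is a leaf, so every return to it crosses
-- the edge {0, 1}. Consecutive visits to the source are at most F = ⌊B⌋ steps apart, and
-- the M(M+1)/2 clique edges need that many traversals, so the edge {0, 1} is crossed
-- at least about M²/F times. Every other edge needs only one traversal, so the penalty
-- is at least the number of crossings minus one, which is quadratic in M, while
-- |V| = h + M + 1 is linear in M.

open import Defs

module Combinatorial where

  open import Data.Bool using (true; false; if_then_else_)
  open import Data.Empty using (⊥)
  open import Data.Fin using (Fin; zero; suc; toℕ; fromℕ<)
  open import Data.Fin.Properties using (suc-injective; toℕ-injective; toℕ-fromℕ<; toℕ<n) renaming (_≟_ to _≟ᶠ_)
  import Data.Integer as ℤ
  import Data.Integer.Properties as ℤ
  open import Data.List using (List; []; _∷_; _++_; map; length; filter; allFin; tabulate)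
  open import Data.List.Properties using (length-++; length-map; length-tabulate; filter-accept)
  open import Data.List.Membership.Propositional using (_∈_)
  open import Data.List.Membership.Propositional.Properties
  open import Data.List.Relation.Unary.Any using (here; there)
  open import Data.List.Relation.Unary.All using (lookup)
  open import Data.List.Relation.Unary.AllPairs using ([]; _∷_)
  open import Data.List.Relation.Unary.Unique.Propositional using (Unique)
  import Data.List.Relation.Unary.Unique.Propositional.Properties as Unique
  open import Data.Maybe using (Maybe; just; nothing; maybe)
  open import Data.Nat using (ℕ; zero; suc; _+_; _*_; _/_; _⊓_; _≤_; _<_; z≤n; s≤s; z<s)
  open import Data.Nat.DivMod using (m*n/n≡m; /-monoˡ-≤)
  open import Data.Nat.ListAction using (sum)
  open import Data.Nat.Properties hiding (suc-injective)
  open import Data.Nat.Tactic.RingSolver using (solve-∀)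
  open import Data.Product using (Σ; ∃-syntax; _×_; _,_; proj₁; proj₂)
  open import Data.Product.Properties using (≡-dec)
  open import Data.Sum using (_⊎_; inj₁; inj₂)
  open import Function using (_∘_; id)
  open import Function.Bundles using (_⇔_; mk⇔)
  open import Level using (0ℓ)
  open import Relation.Binary using (Rel; Symmetric)
  import Relation.Binary as B
  open import Relation.Binary.Definitions using (DecidableEquality)
  open import Relation.Binary.PropositionalEquality
  open import Relation.Nullary using (Dec; yes; no; does; ¬_; contradiction)
  open import Relation.Nullary.Decidable using (does-⇔; _⊎-dec_; _×-dec_; ¬?)
  open import Relation.Unary using (Pred; Decidable)
  open import Relation.Unary.Properties using (∁?)

  ∑ : ∀ {N} → (Fin N → ℕ) → ℕ
  ∑ {zero}  f = 0
  ∑ {suc N} f = f zero + ∑ (f ∘ suc)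

  ∑-cong : ∀ {N} {f g : Fin N → ℕ} → (∀ i → f i ≡ g i) → ∑ f ≡ ∑ g
  ∑-cong {zero}  f≡g = refl
  ∑-cong {suc N} f≡g = cong₂ _+_ (f≡g zero) (∑-cong (f≡g ∘ suc))

  ∑-mono-≤ : ∀ {N} {f g : Fin N → ℕ} → (∀ i → f i ≤ g i) → ∑ f ≤ ∑ g
  ∑-mono-≤ {zero}  f≤g = z≤n
  ∑-mono-≤ {suc N} f≤g = +-mono-≤ (f≤g zero) (∑-mono-≤ (f≤g ∘ suc))

  ∑-*-distribʳ : ∀ {N} (f : Fin N → ℕ) m → ∑ (λ i → f i * m) ≡ ∑ f * m
  ∑-*-distribʳ {zero}  f m = refl
  ∑-*-distribʳ {suc N} f m =
    trans (cong (f zero * m +_) (∑-*-distribʳ (f ∘ suc) m)) (sym (*-distribʳ-+ m (f zero) (∑ (f ∘ suc))))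

  sum-map-tabulate : ∀ {N} {A : Set} (f : A → ℕ) (g : Fin N → A) → sum (map f (tabulate g)) ≡ ∑ (f ∘ g)
  sum-map-tabulate {zero}  f g = refl
  sum-map-tabulate {suc N} f g = cong (f (g zero) +_) (sum-map-tabulate f (g ∘ suc))

  indicator : ∀ {A : Set} → Dec A → ℕ
  indicator a? = if does a? then 1 else 0

  indicator≤1 : ∀ {A : Set} (a? : Dec A) → indicator a? ≤ 1
  indicator≤1 (yes _) = ≤-refl
  indicator≤1 (no _)  = z≤n

  indicator-mono : ∀ {A B : Set} → (A → B) → (a? : Dec A) (b? : Dec B) → indicator a? ≤ indicator b?
  indicator-mono A→B (yes _) (yes _) = ≤-refl
  indicator-mono A→B (yes a) (no ¬b) = contradiction (A→B a) ¬b
  indicator-mono A→B (no _)  _       = z≤n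

  indicator-*-≤ : ∀ {A : Set} (a? : Dec A) {m x} → (A → m ≤ x) → indicator a? * m ≤ x
  indicator-*-≤ (yes a) {m} m≤x = ≤-trans (≤-reflexive (+-identityʳ m)) (m≤x a)
  indicator-*-≤ (no _)      _   = z≤n

  count : ∀ {N} {P : Pred (Fin N) 0ℓ} → Decidable P → ℕ
  count P? = ∑ (indicator ∘ P?)

  count-cong : ∀ {N} {P Q : Pred (Fin N) 0ℓ} (P? : Decidable P) (Q? : Decidable Q) →
               (∀ i → P i ⇔ Q i) → count P? ≡ count Q?
  count-cong P? Q? P⇔Q = ∑-cong (λ i → cong (if_then 1 else 0) (does-⇔ (P⇔Q i) (P? i) (Q? i)))

  count-mono : ∀ {N} {P Q : Pred (Fin N) 0ℓ} (P? : Decidable P) (Q? : Decidable Q) →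
               (∀ i → P i → Q i) → count P? ≤ count Q?
  count-mono P? Q? P⊆Q = ∑-mono-≤ (λ i → indicator-mono (P⊆Q i) (P? i) (Q? i))

  count-all : ∀ {N} {P : Pred (Fin N) 0ℓ} (P? : Decidable P) → (∀ i → P i) → count P? ≡ N
  count-all {zero}  P? all = refl
  count-all {suc N} P? all with P? zero
  ... | yes _ = cong suc (count-all (P? ∘ suc) (all ∘ suc))
  ... | no ¬p = contradiction (all zero) ¬p

  count-≤toℕ : ∀ h k → count {h + k} (λ i → h ≤? toℕ i) ≡ k
  count-≤toℕ zero    k = count-all (λ i → 0 ≤? toℕ i) (λ _ → z≤n)
  count-≤toℕ (suc h) k = trans (count-cong {h + k} (λ i → suc h ≤? suc (toℕ i)) (λ i → h ≤? toℕ i) (λ _ → mk⇔ ≤-pred s≤s))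
                               (count-≤toℕ h k)

  count-all-but-one : ∀ {N} {P Q : Pred (Fin N) 0ℓ} (P? : Decidable P) (Q? : Decidable Q) v →
                      (∀ w → w ≢ v → P w → Q w) → count P? ≤ suc (count Q?)
  count-all-but-one {suc N} P? Q? zero P⊆Q = begin
    indicator (P? zero) + count (P? ∘ suc) ≤⟨ +-mono-≤ (indicator≤1 (P? zero))
                                               (count-mono (P? ∘ suc) (Q? ∘ suc) (λ w → P⊆Q (suc w) (λ ()))) ⟩
    suc (count (Q? ∘ suc))                 ≤⟨ s≤s (m≤n+m _ _) ⟩
    suc (count Q?)                         ∎
    where open ≤-Reasoning
  count-all-but-one {suc N} P? Q? (suc v) P⊆Q = begin
    indicator (P? zero) + count (P? ∘ suc)       ≤⟨ +-mono-≤ (indicator-mono (P⊆Q zero (λ ())) (P? zero) (Q? zero))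
                                                     (count-all-but-one (P? ∘ suc) (Q? ∘ suc) v
                                                       (λ w w≢v → P⊆Q (suc w) (w≢v ∘ suc-injective))) ⟩
    indicator (Q? zero) + suc (count (Q? ∘ suc)) ≡⟨ +-suc _ _ ⟩
    suc (count Q?)                               ∎
    where open ≤-Reasoning

  nth : ∀ {N} {P : Pred (Fin N) 0ℓ} (P? : Decidable P) → Fin (count P?) → Fin N
  nth {suc N} P? i with P? zero
  nth {suc N} P? zero    | yes _ = zero
  nth {suc N} P? (suc i) | yes _ = suc (nth (P? ∘ suc) i)
  nth {suc N} P? i       | no _  = suc (nth (P? ∘ suc) i)

  nth-satisfies : ∀ {N} {P : Pred (Fin N) 0ℓ} (P? : Decidable P) i → P (nth P? i)
  nth-satisfies {suc N} P? i with P? zero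
  nth-satisfies {suc N} P? zero    | yes p = p
  nth-satisfies {suc N} P? (suc i) | yes _ = nth-satisfies (P? ∘ suc) i
  nth-satisfies {suc N} P? i       | no _  = nth-satisfies (P? ∘ suc) i

  nth-injective : ∀ {N} {P : Pred (Fin N) 0ℓ} (P? : Decidable P) {i j} → nth P? i ≡ nth P? j → i ≡ j
  nth-injective {suc N} P? {i} {j} eq with P? zero
  nth-injective {suc N} P? {zero}  {zero}  eq | yes _ = refl
  nth-injective {suc N} P? {suc i} {suc j} eq | yes _ = cong suc (nth-injective (P? ∘ suc) (suc-injective eq))
  nth-injective {suc N} P? {i}     {j}     eq | no _  = nth-injective (P? ∘ suc) (suc-injective eq)

  rank : ∀ {N} {P : Pred (Fin N) 0ℓ} (P? : Decidable P) {w} → P w → Fin (count P?)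
  rank {suc N} P? {w} pw with P? zero | w
  ... | yes _  | zero  = zero
  ... | yes _  | suc w = suc (rank (P? ∘ suc) pw)
  ... | no ¬p0 | zero  = contradiction pw ¬p0
  ... | no _   | suc w = rank (P? ∘ suc) pw

  nth-rank : ∀ {N} {P : Pred (Fin N) 0ℓ} (P? : Decidable P) {w} (pw : P w) → nth P? (rank P? pw) ≡ w
  nth-rank {suc N} P? {w} pw with P? zero | w
  ... | yes _  | zero  = refl
  ... | yes _  | suc w = cong suc (nth-rank (P? ∘ suc) pw)
  ... | no ¬p0 | zero  = contradiction pw ¬p0
  ... | no _   | suc w = cong suc (nth-rank (P? ∘ suc) pw)

  rank-nth : ∀ {N} {P : Pred (Fin N) 0ℓ} (P? : Decidable P) i (p : P (nth P? i)) → rank P? p ≡ i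
  rank-nth P? i p = nth-injective P? (nth-rank P? p)

  target : (G : PortGraph) → Dart G → Fin (n G)
  target G (v , p) = proj₁ (adj G v p)

  reverse : (G : PortGraph) → Dart G → Dart G
  reverse G (v , p) = adj G v p

  reverse-involutive : (G : PortGraph) (d : Dart G) → reverse G (reverse G d) ≡ d
  reverse-involutive G (v , p) = adj-inv G v p

  reverse-into-leaf : (G : PortGraph) {s : Fin (n G)} → (∀ p q → target G (s , p) ≡ target G (s , q)) →
                      (p₀ : Fin (deg G s)) → ∀ d → target G d ≡ s → d ≡ reverse G (s , p₀)
  reverse-into-leaf G one-neighbour p₀ (u , p) refl =
    trans (sym (adj-inv G u p)) (cong (λ q → reverse G (_ , q)) (no-multi G _ _ p₀ (one-neighbour _ p₀)))

  walk-potential : (G : PortGraph) (f : Fin (n G) → ℕ) → (∀ d → f (target G d) ≤ suc (f (proj₁ d))) →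
                   ∀ {u v k} → Walk G u v k → f v ≤ f u + k
  walk-potential G f f-step {u} here = m≤m+n (f u) 0
  walk-potential G f f-step {u} {v} {suc k} (step p W) = begin
    f v                      ≤⟨ walk-potential G f f-step W ⟩
    f (target G (u , p)) + k ≤⟨ +-monoˡ-≤ k (f-step (u , p)) ⟩
    suc (f u) + k            ≡⟨ +-suc (f u) k ⟨
    f u + suc k              ∎
    where open ≤-Reasoning

  module FromRelation {N : ℕ} {_~_ : Rel (Fin N) 0ℓ} (_~?_ : B.Decidable _~_)
                      (~-sym : Symmetric _~_) (~-irrefl : ∀ v → ¬ v ~ v) where

    neighbour : ∀ v → Fin (count (v ~?_)) → Fin N
    neighbour v = nth (v ~?_)

    neighbour-~ : ∀ v p → v ~ neighbour v p
    neighbour-~ v = nth-satisfies (v ~?_)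

    private
      opposite : ∀ v p → Fin (count (neighbour v p ~?_))
      opposite v p = rank (neighbour v p ~?_) (~-sym (neighbour-~ v p))

      port-back : ∀ {v w} (w≡v : w ≡ v) p (pw : w ~ neighbour v p) →
                  _≡_ {A = Σ (Fin N) (λ u → Fin (count (u ~?_)))} (w , rank (w ~?_) pw) (v , p)
      port-back refl p pw = cong (_ ,_) (rank-nth (_ ~?_) p pw)

    graph : PortGraph
    graph = record
      { n         = N
      ; deg       = λ v → count (v ~?_)
      ; adj       = λ v p → neighbour v p , opposite v p
      ; adj-inv   = λ v p → port-back (nth-rank _ (~-sym (neighbour-~ v p))) p _
      ; no-loop   = λ v p loop → ~-irrefl v (subst (v ~_) loop (neighbour-~ v p))
      ; no-multi  = λ v p q → nth-injective (v ~?_)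
      ; label     = λ v → ℤ.+ toℕ v
      ; label-inj = λ eq → toℕ-injective (ℤ.+-injective eq)
      }

    portTo : ∀ {v w} → v ~ w → Fin (deg graph v)
    portTo {v} = rank (v ~?_)

    target-portTo : ∀ {v w} (v~w : v ~ w) → target graph (v , portTo v~w) ≡ w
    target-portTo {v} = nth-rank (v ~?_)

    walk-∷ : ∀ {u v w k} → u ~ w → Walk graph w v k → Walk graph u v (suc k)
    walk-∷ {v = v} {k = k} u~w W = step (portTo u~w) (subst (λ x → Walk graph x v k) (sym (target-portTo u~w)) W)

    walk-snoc : ∀ {u v w k} → Walk graph u w k → w ~ v → Walk graph u v (suc k)
    walk-snoc here       w~v = walk-∷ w~v here
    walk-snoc (step p W) w~v = step p (walk-snoc W w~v)

  length-filter-∁ : ∀ {A : Set} {P : Pred A 0ℓ} (P? : Decidable P) xs →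
                    length xs ≡ length (filter (∁? P?) xs) + length (filter P? xs)
  length-filter-∁ P? [] = refl
  length-filter-∁ P? (x ∷ xs) with P? x
  ... | yes _ = trans (cong suc (length-filter-∁ P? xs)) (sym (+-suc _ _))
  ... | no _  = cong suc (length-filter-∁ P? xs)

  unique⊆⇒length≤ : ∀ {A : Set} {xs ys : List A} → Unique xs → (∀ {x} → x ∈ xs → x ∈ ys) → length xs ≤ length ys
  unique⊆⇒length≤ {xs = []}     _             _      = z≤n
  unique⊆⇒length≤ {xs = x ∷ xs} (x∉xs ∷ uniq) xs⊆ys with ∈-∃++ (xs⊆ys (here refl))
  ... | as , bs , refl = begin
    suc (length xs)             ≤⟨ s≤s (unique⊆⇒length≤ uniq xs⊆as++bs) ⟩
    suc (length (as ++ bs))     ≡⟨ cong suc (length-++ as) ⟩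
    suc (length as + length bs) ≡⟨ +-suc (length as) (length bs) ⟨
    length as + suc (length bs) ≡⟨ length-++ as ⟨
    length (as ++ x ∷ bs)       ∎
    where
      open ≤-Reasoning
      xs⊆as++bs : ∀ {z} → z ∈ xs → z ∈ as ++ bs
      xs⊆as++bs z∈xs with ∈-++⁻ as (xs⊆ys (there z∈xs))
      ... | inj₁ z∈as         = ∈-++⁺ˡ z∈as
      ... | inj₂ (here refl)  = contradiction refl (lookup x∉xs z∈xs)
      ... | inj₂ (there z∈bs) = ∈-++⁺ʳ as z∈bs

  allDarts : ∀ N (d : Fin N → ℕ) → List (Σ (Fin N) (Fin ∘ d))
  allDarts zero    d = []
  allDarts (suc N) d = map (zero ,_) (allFin (d zero)) ++ map (λ (v , p) → suc v , p) (allDarts N (d ∘ suc))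

  length-allDarts : ∀ N d → length (allDarts N d) ≡ ∑ d
  length-allDarts zero    d = refl
  length-allDarts (suc N) d = begin
    length (map (zero ,_) (allFin (d zero)) ++ map _ (allDarts N (d ∘ suc)))
      ≡⟨ length-++ (map (zero ,_) (allFin (d zero))) ⟩
    length (map (zero ,_) (allFin (d zero))) + length (map _ (allDarts N (d ∘ suc)))
      ≡⟨ cong₂ _+_ (trans (length-map _ (allFin (d zero))) (length-tabulate id)) (length-map _ (allDarts N (d ∘ suc))) ⟩
    d zero + length (allDarts N (d ∘ suc))
      ≡⟨ cong (d zero +_) (length-allDarts N (d ∘ suc)) ⟩
    ∑ d ∎
    where open ≡-Reasoning

  allDarts-unique : ∀ N d → Unique (allDarts N d)
  allDarts-unique zero    d = []
  allDarts-unique (suc N) d = Unique.++⁺ (Unique.map⁺ zero,-injective (Unique.allFin⁺ (d zero)))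
                                         (Unique.map⁺ suc,-injective (allDarts-unique N (d ∘ suc)))
                                         disjoint
    where
      zero,-injective : ∀ {p q} → _≡_ {A = Σ (Fin (suc N)) (Fin ∘ d)} (zero , p) (zero , q) → p ≡ q
      zero,-injective refl = refl
      suc,-injective : ∀ {x y : Σ (Fin N) (Fin ∘ d ∘ suc)} →
                       _≡_ {A = Σ (Fin (suc N)) (Fin ∘ d)} (suc (proj₁ x) , proj₂ x) (suc (proj₁ y) , proj₂ y) → x ≡ y
      suc,-injective refl = refl
      disjoint : ∀ {x} → x ∈ map (zero ,_) (allFin (d zero)) × x ∈ map (λ (v , p) → suc v , p) (allDarts N (d ∘ suc)) → ⊥
      disjoint (x∈ˡ , x∈ʳ) with ∈-map⁻ (zero ,_) x∈ˡ | ∈-map⁻ (λ (v , p) → suc v , p) x∈ʳ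
      ... | _ , _ , refl | _ , _ , ()

  numEdges≡∑deg/2 : ∀ G → numEdges G ≡ ∑ (deg G) / 2
  numEdges≡∑deg/2 G = cong (_/ 2) (sum-map-tabulate (deg G) id)

  module RemovedEdge (G : PortGraph) (y : Dart G) where

    OnEdge : Pred (Dart G) 0ℓ
    OnEdge d = d ≡ y ⊎ d ≡ reverse G y

    onEdge? : Decidable OnEdge
    onEdge? d = (d ≟ᵈ y) ⊎-dec (d ≟ᵈ reverse G y)
      where
        _≟ᵈ_ : DecidableEquality (Dart G)
        _≟ᵈ_ = ≡-dec _≟ᶠ_ _≟ᶠ_

    offEdge : List (Dart G) → List (Dart G)
    offEdge = filter (∁? onEdge?)

    reverse-offEdge : ∀ {d} → ¬ OnEdge d → ¬ OnEdge (reverse G d)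
    reverse-offEdge {d} d∉e (inj₁ rd≡y)  =
      d∉e (inj₂ (trans (sym (reverse-involutive G d)) (cong (reverse G) rd≡y)))
    reverse-offEdge {d} d∉e (inj₂ rd≡ry) =
      d∉e (inj₁ (trans (sym (reverse-involutive G d)) (trans (cong (reverse G) rd≡ry) (reverse-involutive G y))))

    ∑deg≤offEdge : ∀ ds → CoversAllEdges G ds → ∑ (deg G) ≤ 2 * suc (length (offEdge ds))
    ∑deg≤offEdge ds covers = begin
      ∑ (deg G)                               ≡⟨ length-allDarts (n G) (deg G) ⟨
      length (allDarts (n G) (deg G))         ≤⟨ unique⊆⇒length≤ (allDarts-unique (n G) (deg G)) (λ {d} _ → ∈-cover d) ⟩
      2 + length (off ++ map (reverse G) off) ≡⟨ cong (2 +_) (trans (length-++ off) (cong (length off +_) (length-map (reverse G) off))) ⟩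
      2 + (length off + length off)           ≡⟨ double-suc (length off) ⟩
      2 * suc (length off)                    ∎
      where
        open ≤-Reasoning
        off : List (Dart G)
        off = offEdge ds
        double-suc : ∀ l → 2 + (l + l) ≡ 2 * suc l
        double-suc = solve-∀
        ∈-cover : ∀ d → d ∈ y ∷ reverse G y ∷ off ++ map (reverse G) off
        ∈-cover d with onEdge? d
        ... | yes (inj₁ refl) = here refl
        ... | yes (inj₂ refl) = there (here refl)
        ... | no d∉e with covers d
        ...   | inj₁ d∈ds  = there (there (∈-++⁺ˡ (∈-filter⁺ (∁? onEdge?) d∈ds d∉e)))
        ...   | inj₂ rd∈ds = there (there (∈-++⁺ʳ off (subst (_∈ map (reverse G) off) (reverse-involutive G d)
                               (∈-map⁺ (reverse G) (∈-filter⁺ (∁? onEdge?) rd∈ds (reverse-offEdge d∉e))))))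

  module Execution (A : Algorithm) (G : PortGraph) (s : Fin (n G)) where

    run : ℕ → Maybe (State G)
    run = runFor A G s

    position : State G → Fin (n G)
    position = proj₁

    traversed : State G → List (Dart G)
    traversed = proj₂ ∘ proj₂

    run-suc-inv : ∀ t {σ′} → run (suc t) ≡ just σ′ →
                  ∃[ σ ] ∃[ d ] (run t ≡ just σ × traversed σ′ ≡ d ∷ traversed σ × position σ′ ≡ target G d)
    run-suc-inv t eq with run t
    ... | nothing with () ← eq
    run-suc-inv t eq | just (v , h , ds) with A (label G s , deg G s) h
    ... | nothing with () ← eq
    ... | just p with p <? deg G v
    ...   | no _ with () ← eq
    run-suc-inv t refl | just (v , h , ds) | just p | yes p<d = (v , h , ds) , (v , fromℕ< p<d) , refl , refl , refl

    length-traversed : ∀ t {σ} → run t ≡ just σ → length (traversed σ) ≡ t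
    length-traversed zero    refl = refl
    length-traversed (suc t) eq′ with σ , d , eq , refl , _ ← run-suc-inv t eq′ = cong suc (length-traversed t eq)

    posAt-inv : ∀ t {v} → posAt A G s t ≡ just v → ∃[ σ ] (run t ≡ just σ × position σ ≡ v)
    posAt-inv t eq with run t
    posAt-inv t refl | just σ = σ , refl , refl

  module FuelBound (A : Algorithm) (G : PortGraph) (s : Fin (n G))
                   {Q : Pred (Dart G) 0ℓ} (Q? : Decidable Q) (into-s : ∀ d → target G d ≡ s → Q d) where

    open Execution A G s

    crossings : List (Dart G) → ℕ
    crossings ds = length (filter Q? ds)

    crossings-∷ : ∀ d ds → crossings ds ≤ crossings (d ∷ ds)
    crossings-∷ d ds with does (Q? d)
    ... | true  = n≤1+n _
    ... | false = ≤-refl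

    crossingsAt : ℕ → ℕ
    crossingsAt t = maybe (crossings ∘ traversed) 0 (run t)

    crossingsAt-just : ∀ t {σ} → run t ≡ just σ → crossingsAt t ≡ crossings (traversed σ)
    crossingsAt-just t = cong (maybe (crossings ∘ traversed) 0)

    crossingsAt-step : ∀ t {σ′} → run (suc t) ≡ just σ′ → crossingsAt t ≤ crossingsAt (suc t)
    crossingsAt-step t {σ′} eq′ with σ , d , eq , tσ′ , _ ← run-suc-inv t eq′ = begin
      crossingsAt t               ≡⟨ crossingsAt-just t eq ⟩
      crossings (traversed σ)     ≤⟨ crossings-∷ d (traversed σ) ⟩
      crossings (d ∷ traversed σ) ≡⟨ cong crossings tσ′ ⟨
      crossings (traversed σ′)    ≡⟨ crossingsAt-just (suc t) eq′ ⟨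
      crossingsAt (suc t)         ∎
      where open ≤-Reasoning

    crossingsAt-return : ∀ t {σ′} → run (suc t) ≡ just σ′ → position σ′ ≡ s → crossingsAt t < crossingsAt (suc t)
    crossingsAt-return t {σ′} eq′ at-s with σ , d , eq , tσ′ , pos ← run-suc-inv t eq′ = begin-strict
      crossingsAt t                 ≡⟨ crossingsAt-just t eq ⟩
      crossings (traversed σ)       <⟨ n<1+n _ ⟩
      suc (crossings (traversed σ)) ≡⟨ cong length (filter-accept Q? (into-s d (trans (sym pos) at-s))) ⟨
      crossings (d ∷ traversed σ)   ≡⟨ cong crossings tσ′ ⟨
      crossings (traversed σ′)      ≡⟨ crossingsAt-just (suc t) eq′ ⟨
      crossingsAt (suc t)           ∎
      where open ≤-Reasoning

    crossingsAt-mono : ∀ {t} t′ {σ′} → t ≤ t′ → run t′ ≡ just σ′ → crossingsAt t ≤ crossingsAt t′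
    crossingsAt-mono zero     z≤n eq′ = ≤-refl
    crossingsAt-mono (suc t′) t≤t′+1 eq′ with m≤n⇒m<n∨m≡n t≤t′+1
    ... | inj₂ refl = ≤-refl
    ... | inj₁ (s≤s t≤t′) with σ , _ , eq , _ ← run-suc-inv t′ eq′ =
      ≤-trans (crossingsAt-mono t′ t≤t′ eq) (crossingsAt-step t′ eq′)

    module _ {F T} (respects-fuel : RespectsFuel A G s F T) {σ} (run-T : run T ≡ just σ) where

      -- A visit to s is followed within F steps by the end of the run or by a return to s,
      -- and every return crosses Q.
      visits : ∀ j → T ≤ j * F ⊎ ∃[ t ] (t ≤ j * F × t ≤ T × posAt A G s t ≡ just s × j ≤ crossingsAt t)
      visits zero = inj₂ (0 , z≤n , z≤n , refl , z≤n)
      visits (suc j) with visits j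
      ... | inj₁ T≤jF = inj₁ (≤-trans T≤jF (m≤n+m (j * F) F))
      ... | inj₂ (t , t≤jF , t≤T , at-s , j≤cₜ) with t + F <? T
      ...   | no t+F≮T = inj₁ (≤-trans (≮⇒≥ t+F≮T) t+F≤[1+j]F)
        where
          t+F≤[1+j]F : t + F ≤ suc j * F
          t+F≤[1+j]F = ≤-trans (+-monoˡ-≤ F t≤jF) (≤-reflexive (+-comm (j * F) F))
      ...   | yes t+F<T with respects-fuel t t+F<T at-s
      ...     | suc k , s≤s t≤k , k+1≤t+F , at-s′ with σ′ , run-k+1 , pos ← posAt-inv (suc k) at-s′ =
        inj₂ (suc k , ≤-trans k+1≤t+F t+F≤[1+j]F , <⇒≤ (≤-<-trans k+1≤t+F t+F<T) , at-s′ , 1+j≤c)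
        where
          t+F≤[1+j]F : t + F ≤ suc j * F
          t+F≤[1+j]F = ≤-trans (+-monoˡ-≤ F t≤jF) (≤-reflexive (+-comm (j * F) F))
          1+j≤c : suc j ≤ crossingsAt (suc k)
          1+j≤c = ≤-trans (s≤s (≤-trans j≤cₜ (crossingsAt-mono k t≤k (proj₁ (proj₂ (proj₂ (run-suc-inv k run-k+1)))))))
                          (crossingsAt-return k run-k+1 pos)

      length-bound : T ≤ suc (crossings (traversed σ)) * F
      length-bound with visits (suc (crossings (traversed σ)))
      ... | inj₁ T≤ = T≤
      ... | inj₂ (t , _ , t≤T , _ , c<cₜ) =
        contradiction (≤-trans (crossingsAt-mono T t≤T run-T) (≤-reflexive (crossingsAt-just T run-T))) (<⇒≱ c<cₜ)

  -- Nodes 0, …, h form a path and nodes h, …, h + M a clique; the source is node 0, and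
  -- level j = min(j, h + 1) is the distance from it to node j.
  module Lollipop (k M : ℕ) where

    h r N : ℕ
    h = suc k
    r = suc h
    N = h + suc M

    Joined : Rel ℕ 0ℓ
    Joined i j = (suc i ≡ j ⊎ suc j ≡ i) ⊎ (h ≤ i × h ≤ j × i ≢ j)

    joined? : B.Decidable Joined
    joined? i j = ((suc i ≟ j) ⊎-dec (suc j ≟ i)) ⊎-dec ((h ≤? i) ×-dec (h ≤? j) ×-dec ¬? (i ≟ j))

    joined-sym : Symmetric Joined
    joined-sym (inj₁ (inj₁ i+1≡j))       = inj₁ (inj₂ i+1≡j)
    joined-sym (inj₁ (inj₂ j+1≡i))       = inj₁ (inj₁ j+1≡i)
    joined-sym (inj₂ (h≤i , h≤j , i≢j)) = inj₂ (h≤j , h≤i , i≢j ∘ sym)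

    joined-irrefl : ∀ {i} → ¬ Joined i i
    joined-irrefl (inj₁ (inj₁ i+1≡i))   = 1+n≢n i+1≡i
    joined-irrefl (inj₁ (inj₂ i+1≡i))   = 1+n≢n i+1≡i
    joined-irrefl (inj₂ (_ , _ , i≢i)) = i≢i refl

    joined-zero : ∀ {j} → Joined 0 j → j ≡ 1
    joined-zero (inj₁ (inj₁ 1≡j)) = sym 1≡j

    _~_ : Rel (Fin N) 0ℓ
    v ~ w = Joined (toℕ v) (toℕ w)

    _~?_ : B.Decidable _~_
    v ~? w = joined? (toℕ v) (toℕ w)

    open FromRelation _~?_ joined-sym (λ _ → joined-irrefl) public

    source : Fin N
    source = zero

    source-leaf : ∀ p q → target graph (source , p) ≡ target graph (source , q)
    source-leaf p q = toℕ-injective (trans (joined-zero (neighbour-~ source p)) (sym (joined-zero (neighbour-~ source q))))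

    source-port : Fin (deg graph source)
    source-port = portTo {source} {fromℕ< 1<N} (inj₁ (inj₁ (sym (toℕ-fromℕ< 1<N))))
      where
        1<N : 1 < N
        1<N = s≤s (≤-trans (s≤s z≤n) (m≤n+m (suc M) k))

    level : ℕ → ℕ
    level j = j ⊓ r

    level-joined : ∀ {i j} → Joined i j → level j ≤ suc (level i)
    level-joined {i}     (inj₁ (inj₁ refl))    = s≤s (⊓-monoʳ-≤ i (n≤1+n h))
    level-joined {i}     (inj₁ (inj₂ refl))    = m≤n⇒m≤1+n (⊓-monoˡ-≤ r (n≤1+n _))
    level-joined {i} {j} (inj₂ (h≤i , _ , _)) = ≤-trans (m⊓n≤n j r) (s≤s (⊓-glb h≤i (n≤1+n h)))

    path-walk : ∀ l {u v} → toℕ u + l ≡ toℕ v → Walk graph u v l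
    path-walk zero    {u} {v} u+0≡v =
      subst (λ x → Walk graph u x 0) (toℕ-injective (trans (sym (+-identityʳ _)) u+0≡v)) here
    path-walk (suc l) {u} {v} u+l+1≡v =
      walk-∷ (inj₁ (inj₁ (sym (toℕ-fromℕ< u+1<N)))) (path-walk l (trans (cong (_+ l) (toℕ-fromℕ< u+1<N)) u+1+l≡v))
      where
        u+1+l≡v : suc (toℕ u) + l ≡ toℕ v
        u+1+l≡v = trans (sym (+-suc _ l)) u+l+1≡v
        u+1<N : suc (toℕ u) < N
        u+1<N = ≤-<-trans (≤-trans (m≤m+n _ l) (≤-reflexive u+1+l≡v)) (toℕ<n v)

    walk-from-source : ∀ v → Walk graph source v (level (toℕ v))
    walk-from-source v with toℕ v ≤? h
    ... | yes v≤h = subst (Walk graph source v) (sym (m≤n⇒m⊓n≡m (m≤n⇒m≤1+n v≤h))) (path-walk (toℕ v) refl)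
    ... | no v≰h  = subst (Walk graph source v) (sym (m≥n⇒m⊓n≡n (≰⇒> v≰h)))
                      (walk-snoc (path-walk h (sym (toℕ-fromℕ< h<N))) hub~v)
      where
        h<N : h < N
        h<N = m<m+n h z<s
        hub~v : fromℕ< h<N ~ v
        hub~v = inj₂ ( ≤-reflexive (sym (toℕ-fromℕ< h<N)) , <⇒≤ (≰⇒> v≰h)
                     , λ h≡v → v≰h (≤-reflexive (trans (sym h≡v) (toℕ-fromℕ< h<N))))

    distance-from-source : ∀ v → Distance graph source v (level (toℕ v))
    distance-from-source v =
      walk-from-source v , λ _ → walk-potential graph (level ∘ toℕ) (λ (u , p) → level-joined (neighbour-~ u p))

    eccentricity : 1 ≤ M → Eccentricity graph source r
    eccentricity 1≤M = (λ v → level (toℕ v) , distance-from-source v , m⊓n≤n (toℕ v) r)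
                     , far , subst (Distance graph source far) level-far (distance-from-source far)
      where
        r<N : r < N
        r<N = ≤-trans (≤-reflexive (+-comm 2 h)) (+-monoʳ-≤ h (s≤s 1≤M))
        far : Fin N
        far = fromℕ< r<N
        level-far : level (toℕ far) ≡ r
        level-far = trans (cong level (toℕ-fromℕ< r<N)) (⊓-idem r)

    InClique : Pred (Fin N) 0ℓ
    InClique w = h ≤ toℕ w

    inClique? : Decidable InClique
    inClique? w = h ≤? toℕ w

    clique-order : count inClique? ≡ suc M
    clique-order = count-≤toℕ h (suc M)

    clique-degree : ∀ v → InClique v → M ≤ deg graph v
    clique-degree v h≤v = ≤-pred (begin
      suc M             ≡⟨ clique-order ⟨
      count inClique?   ≤⟨ count-all-but-one inClique? (v ~?_) v v~w ⟩
      suc (deg graph v) ∎)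
      where
        open ≤-Reasoning
        v~w : ∀ w → w ≢ v → InClique w → v ~ w
        v~w w w≢v h≤w = inj₂ (h≤v , h≤w , w≢v ∘ sym ∘ toℕ-injective)

    degree-sum : suc M * M ≤ ∑ (deg graph)
    degree-sum = begin
      suc M * M                             ≡⟨ cong (_* M) clique-order ⟨
      count inClique? * M                   ≡⟨ ∑-*-distribʳ {N} (indicator ∘ inClique?) M ⟨
      ∑ (λ w → indicator (inClique? w) * M) ≤⟨ ∑-mono-≤ (λ v → indicator-*-≤ (inClique? v) (clique-degree v)) ⟩
      ∑ (deg graph)                         ∎
      where open ≤-Reasoning

  half-≤ : ∀ {m l} → m ≤ 2 * l → m / 2 ≤ l
  half-≤ {m} {l} m≤2l = ≤-trans (/-monoˡ-≤ 2 m≤2l) (≤-reflexive (trans (cong (_/ 2) (*-comm 2 l)) (m*n/n≡m l 2)))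

  linear<quadratic : ∀ {a b m} → a < m → b ≤ m → a + b * m < suc m * m
  linear<quadratic {m = m} a<m b≤m = +-mono-<-≤ a<m (*-monoˡ-≤ m b≤m)

  -- With a = 2 (1 + (K (h + 1) + 2) F) and b = 2 K F, the order M = 1 + a + b makes
  -- M (M + 1) exceed a + b M = 2 (1 + (K |V| + 2) F), where |V| = h + 1 + M.
  cliqueSize : (K F h : ℕ) → ℕ
  cliqueSize K F h = suc (2 * suc ((K * suc h + 2) * F) + 2 * (K * F))

  many-crossings : ∀ K F h c → let M = cliqueSize K F h in
                   suc M * M ≤ 2 * suc (suc c * F) → K * (h + suc M) + 2 ≤ c
  many-crossings K F h c bound = ≮⇒≥ λ c<KN+2 →
    <⇒≱ (linear<quadratic {a} {b} {M} (s≤s (m≤m+n a b)) (m≤n+m b (suc a))) (begin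
      suc M * M                           ≤⟨ bound ⟩
      2 * suc (suc c * F)                 ≤⟨ *-monoʳ-≤ 2 (s≤s (*-monoˡ-≤ F c<KN+2)) ⟩
      2 * suc ((K * (h + suc M) + 2) * F) ≡⟨ split K F h M ⟩
      a + b * M                           ∎)
    where
      open ≤-Reasoning
      M a b : ℕ
      M = cliqueSize K F h
      a = 2 * suc ((K * suc h + 2) * F)
      b = 2 * (K * F)
      split : ∀ K F h M → 2 * suc ((K * (h + suc M) + 2) * F) ≡ 2 * suc ((K * suc h + 2) * F) + 2 * (K * F) * M
      split = solve-∀

  excess-< : ∀ {a e l c} → e ≤ suc l → a + 2 ≤ c → a + e < l + c
  excess-< {a} {e} {l} {c} e≤l+1 a+2≤c = begin-strict
    a + e           ≤⟨ +-monoʳ-≤ a e≤l+1 ⟩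
    a + suc l       <⟨ n<1+n _ ⟩
    suc (a + suc l) ≡⟨ rearrange a l ⟩
    (a + 2) + l     ≤⟨ +-monoˡ-≤ l a+2≤c ⟩
    c + l           ≡⟨ +-comm c l ⟩
    l + c           ∎
    where
      open ≤-Reasoning
      rearrange : ∀ a l → suc (a + suc l) ≡ (a + 2) + l
      rearrange = solve-∀

  lollipop-penalty-exceeds : ∀ (A : Algorithm) K F k → let open Lollipop k (cliqueSize K F (suc k)) in
                             ∀ {T} → ExploresIn A graph source F T → K * numNodes graph + numEdges graph < T
  lollipop-penalty-exceeds A K F k {T} (ds , (_ , _ , run-T , _) , respects-fuel , covers) =
    subst (K * N + numEdges graph <_) l+c≡T (excess-< edges≤ (many-crossings K F (suc k) c clique-bound))
    where
      M : ℕ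
      M = cliqueSize K F (suc k)
      open Lollipop k M
      y : Dart graph
      y = source , source-port
      open RemovedEdge graph y
      open Execution A graph source
      open FuelBound A graph source onEdge? (λ d d→s → inj₂ (reverse-into-leaf graph source-leaf source-port d d→s))
      l c : ℕ
      l = length (offEdge ds)
      c = crossings ds
      l+c≡T : l + c ≡ T
      l+c≡T = trans (sym (length-filter-∁ onEdge? ds)) (length-traversed T run-T)
      edges≤ : numEdges graph ≤ suc l
      edges≤ = ≤-trans (≤-reflexive (numEdges≡∑deg/2 graph)) (half-≤ (∑deg≤offEdge ds covers))
      clique-bound : suc M * M ≤ 2 * suc (suc c * F)
      clique-bound = begin
        suc M * M           ≤⟨ degree-sum ⟩
        ∑ (deg graph)       ≤⟨ ∑deg≤offEdge ds covers ⟩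
        2 * suc l           ≤⟨ *-monoʳ-≤ 2 (s≤s (≤-trans (m≤m+n l c) (≤-reflexive l+c≡T))) ⟩
        2 * suc T           ≤⟨ *-monoʳ-≤ 2 (s≤s (length-bound respects-fuel run-T)) ⟩
        2 * suc (suc c * F) ∎
        where open ≤-Reasoning

module ℕ-in-ℚ where

  open import Data.Integer as ℤ using (+_; +<+; +≤+; -[1+_]; -≤+)
  import Data.Integer.Properties as ℤ
  open import Data.Nat as ℕ using (ℕ; suc)
  import Data.Nat.Properties as ℕ
  open import Data.Nat.Coprimality using (1-coprimeTo) renaming (sym to coprime-sym)
  open import Data.Product using (∃-syntax; _,_)
  open import Data.Rational
  open import Data.Rational.Properties
  import Data.Rational.Unnormalised as ℚᵘ
  import Data.Rational.Unnormalised.Properties as ℚᵘ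
  open import Relation.Binary.PropositionalEquality

  toℚ : ℕ → ℚ
  toℚ m = + m / 1

  toℚ≡mkℚ : ∀ m → toℚ m ≡ mkℚ (+ m) 0 (coprime-sym (1-coprimeTo m))
  toℚ≡mkℚ m = normalize-coprime (coprime-sym (1-coprimeTo m))

  toℚ-mono-< : ∀ {a b} → a ℕ.< b → toℚ a < toℚ b
  toℚ-mono-< {a} {b} a<b rewrite toℚ≡mkℚ a | toℚ≡mkℚ b =
    *<* (subst₂ ℤ._<_ (sym (ℤ.*-identityʳ (+ a))) (sym (ℤ.*-identityʳ (+ b))) (+<+ a<b))

  toℚ-homo-+ : ∀ a b → toℚ (a ℕ.+ b) ≡ toℚ a + toℚ b
  toℚ-homo-+ a b = toℚᵘ-injective (ℚᵘ.≃-trans ᵘ-homo (ℚᵘ.≃-sym (toℚᵘ-homo-+ (toℚ a) (toℚ b))))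
    where
      ᵘ-homo : toℚᵘ (toℚ (a ℕ.+ b)) ℚᵘ.≃ toℚᵘ (toℚ a) ℚᵘ.+ toℚᵘ (toℚ b)
      ᵘ-homo rewrite toℚ≡mkℚ a | toℚ≡mkℚ b | toℚ≡mkℚ (a ℕ.+ b) =
        ℚᵘ.*≡* (cong (ℤ._* + 1) (trans (sym (ℤ.pos-+ a b)) (sym (cong₂ ℤ._+_ (ℤ.*-identityʳ (+ a)) (ℤ.*-identityʳ (+ b))))))

  toℚ-homo-* : ∀ a b → toℚ (a ℕ.* b) ≡ toℚ a * toℚ b
  toℚ-homo-* a b = toℚᵘ-injective (ℚᵘ.≃-trans ᵘ-homo (ℚᵘ.≃-sym (toℚᵘ-homo-* (toℚ a) (toℚ b))))
    where
      ᵘ-homo : toℚᵘ (toℚ (a ℕ.* b)) ℚᵘ.≃ toℚᵘ (toℚ a) ℚᵘ.* toℚᵘ (toℚ b)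
      ᵘ-homo rewrite toℚ≡mkℚ a | toℚ≡mkℚ b | toℚ≡mkℚ (a ℕ.* b) =
        ℚᵘ.*≡* (cong (ℤ._* + 1) (ℤ.pos-* a b))

  bounded-by-ℕ : ∀ q → ∃[ K ] (q ≤ toℚ K)
  bounded-by-ℕ (mkℚ (+ m) d c) = m , subst (mkℚ (+ m) d c ≤_) (sym (toℚ≡mkℚ m))
    (*≤* (subst₂ ℤ._≤_ (sym (ℤ.*-identityʳ (+ m))) (ℤ.pos-* m (suc d)) (+≤+ (ℕ.m≤m*n m (suc d)))))
  bounded-by-ℕ (mkℚ -[1+ m ] d c) = 0 , subst (mkℚ -[1+ m ] d c ≤_) (sym (toℚ≡mkℚ 0)) (*≤* -≤+)

  q*a<t-b : ∀ {q K a b t} → q ≤ toℚ K → K ℕ.* a ℕ.+ b ℕ.< t → q * toℚ a < toℚ t - toℚ b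
  q*a<t-b {q} {K} {a} {b} {t} q≤K Ka+b<t = begin-strict
    q * toℚ a                       ≤⟨ *-monoʳ-≤-nonNeg (toℚ a) {{normalize-nonNeg a 1}} q≤K ⟩
    toℚ K * toℚ a                   ≡⟨ toℚ-homo-* K a ⟨
    toℚ (K ℕ.* a)                   ≡⟨ +-identityʳ (toℚ (K ℕ.* a)) ⟨
    toℚ (K ℕ.* a) + 0ℚ              ≡⟨ cong (_+_ (toℚ (K ℕ.* a))) (+-inverseʳ (toℚ b)) ⟨
    toℚ (K ℕ.* a) + (toℚ b - toℚ b) ≡⟨ +-assoc (toℚ (K ℕ.* a)) (toℚ b) (- toℚ b) ⟨
    (toℚ (K ℕ.* a) + toℚ b) - toℚ b ≡⟨ cong (_- toℚ b) (toℚ-homo-+ (K ℕ.* a) b) ⟨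
    toℚ (K ℕ.* a ℕ.+ b) - toℚ b     <⟨ +-monoˡ-< (- toℚ b) (toℚ-mono-< Ka+b<t) ⟩
    toℚ t - toℚ b                   ∎
    where open ≤-Reasoning

open Combinatorial using (module Lollipop; cliqueSize; lollipop-penalty-exceeds)
open ℕ-in-ℚ using (toℚ; bounded-by-ℕ; q*a<t-b)

open import Data.Nat using (ℕ; suc; _≤_; z≤n; s≤s)
open import Data.Integer using (+_)
open import Data.Fin using (Fin)
open import Data.Product using (∃-syntax; _×_; _,_; proj₁; proj₂)
open import Data.Rational using (ℚ; Positive; 1ℚ; _/_; _*_) renaming (_≤_ to _≤ℚ_)

-- The construction works for every fuel bound.
corollary2 : (α : ℚ) → Positive α → (r : ℕ) → 2 ≤ r → 1ℚ ≤ℚ ((+ r / 1) * α) →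
    (A : Algorithm) → SolvesAll α r A →
    (C : ℚ) → Positive C →
    ∃[ G ] ∃[ s ] (InInstances G s r × ∃[ T ] (ExploresIn A G s (fuel α r) T × PenaltyExceeds G T C))
corollary2 α _ (suc (suc k)) (s≤s (s≤s _)) _ A solves C _ =
  graph , source , ecc , T , explores , q*a<t-b {K = K} C≤K (lollipop-penalty-exceeds A K F k explores)
  where
    F K : ℕ
    F = fuel α (suc (suc k))
    K = proj₁ (bounded-by-ℕ C)
    C≤K : C ≤ℚ toℚ K
    C≤K = proj₂ (bounded-by-ℕ C)
    open Lollipop k (cliqueSize K F (suc k))
    ecc : Eccentricity graph source (suc (suc k))
    ecc = eccentricity (s≤s z≤n)
    T : ℕ
    T = proj₁ (solves graph source ecc)
    explores : ExploresIn A graph source F T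
    explores = proj₂ (solves graph source ecc)
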